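{- (1) The category $\mathbf{SIF}$ is a full reflective subcategory of $\mathbf{CIF}$. (2) The categories $\mathbf{SIF}$ and $\mathbf{CIF}$ are equivalent.
   Context: A continuous information frame is a triple $\mathbb{A}=(A,(\mathrm{Con}_i)_{i\in A},(\vDash_i)_{i\in A})$ where $A$ is a set, each $\mathrm{Con}_i$ is a set of finite subsets of $A$, and $\vDash_i\subseteq\mathrm{Con}_i\times A$; write $iRj$ iff $\{i\}\in\mathrm{Con}_j$, and $X\vDash_i Y$ iff $X\vDash_i b$ for all $b\in Y$. Required, for all $i,j,a\in A$ and finite $X,Y\subseteq A$: (i) $\{i\}\in\mathrm{Con}_i$; (ii) if $Y\subseteq X\in\mathrm{Con}_i$ then $Y\in\mathrm{Con}_i$; (iii) if $X\in\mathrm{Con}_i$ and $X\vDash_i Y$ then $Y\in\mathrm{Con}_i$; (iv) if $X,Y\in\mathrm{Con}_i$, $X\subseteq Y$, $X\vDash_i a$ then $Y\vDash_i a$; (v) if $X\in\mathrm{Con}_i$, $X\vDash_i Y$, $Y\vDash_i a$ then $X\vDash_i a$; (vi) if $iRj$ then $\mathrm{Con}_i\subseteq\mathrm{Con}_j$; (vii) if $iRj$, $X\in\mathrm{Con}_i$, $X\vDash_i a$ then $X\vDash_j a$; (viii) if $X\vDash_i Y$ then there exist $e\in A$, $Z\in\mathrm{Con}_e$ with $X\vDash_i \{e\}\cup Z$ and $Z\vDash_e Y$. It is strong if for all $i$ and $X\in\mathrm{Con}_i$ with $X\neq\{i\}$, $\{i\}\vDash_i X$. An approximable family $\mathbb H=(H_i)_{i\in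 A}$ from $\mathbb A$ to $\mathbb A'$ is a family of relations $H_i\subseteq\mathrm{Con}_i\times A'$ (write $XH_iY$ iff $XH_ic$ for all $c\in Y$) such that for all $i,j\in A$, $X,X'\in\mathrm{Con}_i$, $b,k\in A'$, $Y\in\mathrm{Con}'_k$, finite $F\subseteq A'$: (a) $XH_i(\{k\}\cup Y)$ and $Y\vDash'_k b$ imply $XH_ib$; (b) $X\subseteq X'$ and $XH_ib$ imply $X'H_ib$; (c) $X\vDash_iX'$ and $X'H_ib$ imply $XH_ib$; (d) $iRj$ and $XH_ib$ imply $XH_jb$; (e) if $XH_iF$ there are $c\in A$, $e\in A'$, $U\in\mathrm{Con}_c$, $V\in\mathrm{Con}'_e$ with $X\vDash_i\{c\}\cup U$, $UH_c(\{e\}\cup V)$, $V\vDash'_eF$. Composition of $\mathbb G:\mathbb A^{(1)}\to\mathbb A^{(2)}$ and $\mathbb H:\mathbb A^{(2)}\to\mathbb A^{(3)}$: $X(\mathbb G\circ\mathbb H)_ia$ iff there are $e\in A^{(2)}$, $V\in\mathrm{Con}^{(2)}_e$ with $XG_i(\{e\}\cup V)$ and $VH_ea$; identity on $\mathbb A$ is $(\vDash_i)_{i\in A}$. $\mathbf{CIF}$ is the category of continuous information frames and approximable families; $\mathbf{SIF}$ is its full subcategory of strong continuous information frames. -}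

module Defs where

open import Data.List using (List; []; _∷_; [_])
open import Data.List.Membership.Propositional using (_∈_)
open import Data.List.Relation.Binary.Subset.Propositional using (_⊆_)
open import Data.Product using (Σ; _×_; _,_; proj₁; proj₂)
open import Relation.Nullary using (¬_)

-- Finite subsets of a set A are represented by lists; "Y ⊆ X" is membership
-- inclusion.  All structure below is invariant under reordering/duplication
-- by axioms (ii), (iv) and (b).

Lift* : {A B : Set} → (List A → B → Set) → List A → List B → Set
Lift* R X Y = ∀ {b} → b ∈ Y → R X b

record IsCIF (A : Set) (Con : A → List A → Set) (Ent : A → List A → A → Set) : Set where
  field
    ent⇒con : ∀ {i X a} → Ent i X a → Con i X
    ax-i    : ∀ i → Con i [ i ]
    ax-ii   : ∀ {i X Y} → Y ⊆ X → Con i X → Con i Y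
    ax-iii  : ∀ {i X Y} → Con i X → Lift* (Ent i) X Y → Con i Y
    ax-iv   : ∀ {i X Y a} → Con i X → Con i Y → X ⊆ Y → Ent i X a → Ent i Y a
    ax-v    : ∀ {i X Y a} → Con i X → Lift* (Ent i) X Y → Ent i Y a → Ent i X a
    -- iRj  is  {i} ∈ Con_j
    ax-vi   : ∀ {i j X} → Con j [ i ] → Con i X → Con j X
    ax-vii  : ∀ {i j X a} → Con j [ i ] → Con i X → Ent i X a → Ent j X a
    ax-viii : ∀ {i X Y} → Con i X → Lift* (Ent i) X Y →
              Σ A λ e → Σ (List A) λ Z →
                Con e Z × Lift* (Ent i) X (e ∷ Z) × Lift* (Ent e) Z Y

record CIF : Set₁ where
  field
    Car   : Set
    Con   : Car → List Car → Set
    Ent   : Car → List Car → Car → Set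
    isCIF : IsCIF Car Con Ent

open CIF public

IsStrong : CIF → Set
IsStrong 𝔸 = ∀ i X → Con 𝔸 i X → ¬ (X ⊆ [ i ] × [ i ] ⊆ X) → Lift* (Ent 𝔸 i) [ i ] X

RelFam : CIF → CIF → Set₁
RelFam 𝔸 𝔹 = Car 𝔸 → List (Car 𝔸) → Car 𝔹 → Set

record IsApprox (𝔸 𝔹 : CIF) (H : RelFam 𝔸 𝔹) : Set where
  field
    h⇒con : ∀ {i X b} → H i X b → Con 𝔸 i X
    ap-a  : ∀ {i X k Y b} → Con 𝔸 i X → Con 𝔹 k Y →
            Lift* (H i) X (k ∷ Y) → Ent 𝔹 k Y b → H i X b
    ap-b  : ∀ {i X X' b} → Con 𝔸 i X → Con 𝔸 i X' → X ⊆ X' → H i X b → H i X' b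
    ap-c  : ∀ {i X X' b} → Con 𝔸 i X → Con 𝔸 i X' →
            Lift* (Ent 𝔸 i) X X' → H i X' b → H i X b
    ap-d  : ∀ {i j X b} → Con 𝔸 j [ i ] → Con 𝔸 i X → H i X b → H j X b
    ap-e  : ∀ {i X F} → Con 𝔸 i X → Lift* (H i) X F →
            Σ (Car 𝔸) λ c → Σ (Car 𝔹) λ e → Σ (List (Car 𝔸)) λ U → Σ (List (Car 𝔹)) λ V →
              Con 𝔸 c U × Con 𝔹 e V × Lift* (Ent 𝔸 i) X (c ∷ U) ×
              Lift* (H c) U (e ∷ V) × Lift* (Ent 𝔹 e) V F

record Hom (𝔸 𝔹 : CIF) : Set₁ where
  field
    rel      : RelFam 𝔸 𝔹
    isApprox : IsApprox 𝔸 𝔹 rel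

open Hom public

EqR : (𝔸 𝔹 : CIF) → RelFam 𝔸 𝔹 → RelFam 𝔸 𝔹 → Set
EqR 𝔸 𝔹 R S = ∀ i X b → (R i X b → S i X b) × (S i X b → R i X b)

_≈H_ : {𝔸 𝔹 : CIF} → Hom 𝔸 𝔹 → Hom 𝔸 𝔹 → Set
_≈H_ {𝔸} {𝔹} f g = EqR 𝔸 𝔹 (rel f) (rel g)

_≈_ : {𝔸 𝔹 : CIF} → Hom 𝔸 𝔹 → RelFam 𝔸 𝔹 → Set
_≈_ {𝔸} {𝔹} f R = EqR 𝔸 𝔹 (rel f) R

-- composition G ∘ H (diagrammatic: first G then H), on raw relations
compR : (𝔸 𝔹 ℂ : CIF) → RelFam 𝔸 𝔹 → RelFam 𝔹 ℂ → RelFam 𝔸 ℂ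
compR 𝔸 𝔹 ℂ G H i X a =
  Σ (Car 𝔹) λ e → Σ (List (Car 𝔹)) λ V →
    Con 𝔹 e V × Lift* (G i) X (e ∷ V) × H e V a

_⨾_ : {𝔸 𝔹 ℂ : CIF} → Hom 𝔸 𝔹 → Hom 𝔹 ℂ → RelFam 𝔸 ℂ
_⨾_ {𝔸} {𝔹} {ℂ} f g = compR 𝔸 𝔹 ℂ (rel f) (rel g)

idR : (𝔸 : CIF) → RelFam 𝔸 𝔸
idR 𝔸 = Ent 𝔸

-- Categories whose objects carry an underlying CIF and whose hom-sets are
-- all approximable families between the underlying CIFs (full subcategories
-- of CIF).  Functors between such categories; identity and composition laws
-- are stated relationally (a morphism h "is" the composite/identity when its
-- relation family coincides with it).
record Functor {O₁ O₂ : Set₁} (U₁ : O₁ → CIF) (U₂ : O₂ → CIF) : Set₁ where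
  field
    F₀     : O₁ → O₂
    F₁     : ∀ {a b} → Hom (U₁ a) (U₁ b) → Hom (U₂ (F₀ a)) (U₂ (F₀ b))
    F-resp : ∀ {a b} (f g : Hom (U₁ a) (U₁ b)) → f ≈H g → F₁ f ≈H F₁ g
    F-id   : ∀ {a} (h : Hom (U₁ a) (U₁ a)) →
             h ≈ idR (U₁ a) → F₁ h ≈ idR (U₂ (F₀ a))
    F-comp : ∀ {a b c} (f : Hom (U₁ a) (U₁ b)) (g : Hom (U₁ b) (U₁ c))
             (h : Hom (U₁ a) (U₁ c)) →
             h ≈ (f ⨾ g) → F₁ h ≈ (F₁ f ⨾ F₁ g)

open Functor public

idF : {O : Set₁} (U : O → CIF) → Functor U U
idF U = record
  { F₀ = λ a → a ; F₁ = λ f → f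
  ; F-resp = λ f g p → p ; F-id = λ h p → p ; F-comp = λ f g h p → p }

_⨾F_ : {O₁ O₂ O₃ : Set₁} {U₁ : O₁ → CIF} {U₂ : O₂ → CIF} {U₃ : O₃ → CIF} →
       Functor U₁ U₂ → Functor U₂ U₃ → Functor U₁ U₃
F ⨾F G = record
  { F₀ = λ a → F₀ G (F₀ F a)
  ; F₁ = λ f → F₁ G (F₁ F f)
  ; F-resp = λ f g p → F-resp G (F₁ F f) (F₁ F g) (F-resp F f g p)
  ; F-id = λ h p → F-id G (F₁ F h) (F-id F h p)
  ; F-comp = λ f g h p → F-comp G (F₁ F f) (F₁ F g) (F₁ F h) (F-comp F f g h p) }

record NatIso {O₁ O₂ : Set₁} {U₁ : O₁ → CIF} {U₂ : O₂ → CIF}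
              (F G : Functor U₁ U₂) : Set₁ where
  field
    α       : ∀ a → Hom (U₂ (F₀ F a)) (U₂ (F₀ G a))
    α⁻¹     : ∀ a → Hom (U₂ (F₀ G a)) (U₂ (F₀ F a))
    iso₁    : ∀ a → EqR (U₂ (F₀ F a)) (U₂ (F₀ F a)) (α a ⨾ α⁻¹ a) (idR (U₂ (F₀ F a)))
    iso₂    : ∀ a → EqR (U₂ (F₀ G a)) (U₂ (F₀ G a)) (α⁻¹ a ⨾ α a) (idR (U₂ (F₀ G a)))
    natural : ∀ {a b} (f : Hom (U₁ a) (U₁ b)) →
              EqR (U₂ (F₀ F a)) (U₂ (F₀ G b)) (F₁ F f ⨾ α b) (α a ⨾ F₁ G f)

record Equivalence {O₁ O₂ : Set₁} (U₁ : O₁ → CIF) (U₂ : O₂ → CIF) : Set₁ where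
  field
    L    : Functor U₁ U₂
    R    : Functor U₂ U₁
    unit   : NatIso (idF U₁) (L ⨾F R)
    counit : NatIso (R ⨾F L) (idF U₂)

SIFObj : Set₁
SIFObj = Σ CIF IsStrong

-- SIF (a full subcategory of CIF by construction) is reflective in CIF:
-- every CIF 𝔸 has a universal arrow η : 𝔸 → 𝔸ˢ into SIF.
SIFReflective : Set₁
SIFReflective =
  ∀ (𝔸 : CIF) → Σ SIFObj λ 𝕊 → Σ (Hom 𝔸 (proj₁ 𝕊)) λ η →
    ∀ (𝔹 : SIFObj) (f : Hom 𝔸 (proj₁ 𝔹)) →
      Σ (Hom (proj₁ 𝕊) (proj₁ 𝔹)) λ g →
        (f ≈ (η ⨾ g)) ×
        (∀ (g' : Hom (proj₁ 𝕊) (proj₁ 𝔹)) → f ≈ (η ⨾ g') → g' ≈H g)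

{-# OPTIONS --safe #-}
module Submission where

open import Defs
open import Data.Empty using (⊥-elim)
open import Data.List using (List; []; _∷_; [_]; _++_; concatMap)
open import Data.List.Membership.Propositional using (_∈_; find; lose)
open import Data.List.Membership.Propositional.Properties
  using (∈-++⁺ˡ; ∈-++⁺ʳ; ∈-++⁻; ∈-concatMap⁺; ∈-concatMap⁻)
open import Data.List.Relation.Binary.Subset.Propositional using (_⊆_)
open import Data.List.Relation.Unary.Any using (here; there)
open import Data.Product using (Σ; _×_; _,_; proj₁; proj₂; swap)
open import Data.Sum using (_⊎_; inj₁; inj₂; [_,_]′)
open import Function using (_∘_)
open import Relation.Binary.PropositionalEquality using (refl)

-- Every continuous information frame 𝔸 is isomorphic in CIF to a strong one,
-- 𝔸ˢ, whose tokens are the pairs (c , U) with U ∈ Con_c, read as the sets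
-- {c} ∪ U, where (c , U) entails (d , V) when U ⊨_c {d} ∪ V.  The isomorphism
-- is α : 𝔸 → 𝔸ˢ, X α_i (c , U) iff X ⊨_i {c} ∪ U, with inverse β,
-- P β_(c , U) a iff P is consistent and U ⊨_c a.  Conjugating morphisms by
-- these isomorphisms, f ↦ β ⨾ f ⨾ α, makes 𝔸 ↦ 𝔸ˢ a functor inverse to the
-- inclusion of SIF up to α and β; and as α is an isomorphism, every
-- f : 𝔸 → 𝔹 factors uniquely as α ⨾ (β ⨾ f), whether or not 𝔹 is strong.

singleton-all : ∀ {B : Set} {P : B → Set} {b x} → P b → x ∈ [ b ] → P x
singleton-all pb (here refl) = pb
singleton-all pb (there ())

all-++ : ∀ {B : Set} {P : B → Set} xs {ys} →
         (∀ {x} → x ∈ xs → P x) → (∀ {x} → x ∈ ys → P x) →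
         ∀ {x} → x ∈ xs ++ ys → P x
all-++ xs h k m = [ h , k ]′ (∈-++⁻ xs m)

all-concatMap⁺ : ∀ {A B : Set} {P : B → Set} (f : A → List B) {xs} →
                 (∀ {a} → a ∈ xs → ∀ {x} → x ∈ f a → P x) →
                 ∀ {x} → x ∈ concatMap f xs → P x
all-concatMap⁺ f h m with find (∈-concatMap⁻ f m)
... | _ , a∈xs , x∈fa = h a∈xs x∈fa

all-concatMap⁻ : ∀ {A B : Set} {P : B → Set} (f : A → List B) {xs a x} →
                 (∀ {y} → y ∈ concatMap f xs → P y) → a ∈ xs → x ∈ f a → P x
all-concatMap⁻ f h a∈xs x∈fa = h (∈-concatMap⁺ f (lose a∈xs x∈fa))

EqR-sym : ∀ {𝔸 𝔹 R S} → EqR 𝔸 𝔹 R S → EqR 𝔸 𝔹 S R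
EqR-sym R≈S i X b = swap (R≈S i X b)

EqR-trans : ∀ {𝔸 𝔹 R S T} → EqR 𝔸 𝔹 R S → EqR 𝔸 𝔹 S T → EqR 𝔸 𝔹 R T
EqR-trans R≈S S≈T i X b =
  proj₁ (S≈T i X b) ∘ proj₁ (R≈S i X b) , proj₂ (R≈S i X b) ∘ proj₂ (S≈T i X b)

module CIFLaws (𝔸 : CIF) where
  open IsCIF (isCIF 𝔸) public

  Ents : Car 𝔸 → List (Car 𝔸) → List (Car 𝔸) → Set
  Ents i = Lift* (Ent 𝔸 i)

  ent⇒con-singleton : ∀ {i X d} → Ent 𝔸 i X d → Con 𝔸 i [ d ]
  ent⇒con-singleton e = ax-iii (ent⇒con e) (singleton-all e)

  ent-cut : ∀ {i X c U b} → Con 𝔸 c U → Ents i X (c ∷ U) → Ent 𝔸 c U b → Ent 𝔸 i X b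
  ent-cut cU X⊨cU U⊨b =
    ax-v (ent⇒con X⊨c) (λ m → X⊨cU (there m)) (ax-vii (ent⇒con-singleton X⊨c) cU U⊨b)
    where X⊨c = X⊨cU (here refl)

  ent-isApprox : IsApprox 𝔸 𝔸 (Ent 𝔸)
  ent-isApprox = record
    { h⇒con = ent⇒con
    ; ap-a  = λ _ cY → ent-cut cY
    ; ap-b  = ax-iv
    ; ap-c  = λ cX _ → ax-v cX
    ; ap-d  = ax-vii
    ; ap-e  = λ cX X⊨F →
        let (e , Z , cZ , X⊨eZ , Z⊨F) = ax-viii cX X⊨F
            (c , U , cU , X⊨cU , U⊨eZ) = ax-viii cX X⊨eZ
        in c , e , U , Z , cU , cZ , X⊨cU , U⊨eZ , Z⊨F
    }

idᴴ : (𝔸 : CIF) → Hom 𝔸 𝔸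
idᴴ 𝔸 = record { rel = Ent 𝔸 ; isApprox = CIFLaws.ent-isApprox 𝔸 }

module ApproxLaws {𝔸 𝔹 : CIF} {H : RelFam 𝔸 𝔹} (ap : IsApprox 𝔸 𝔹 H) where
  open IsApprox ap public
  private
    module A = CIFLaws 𝔸
    module B = CIFLaws 𝔹

  ap-a* : ∀ {i X k Y Z} → Con 𝔸 i X → Con 𝔹 k Y →
          Lift* (H i) X (k ∷ Y) → B.Ents k Y Z → Lift* (H i) X Z
  ap-a* cX cY XHkY Y⊨Z m = ap-a cX cY XHkY (Y⊨Z m)

  ap-cut : ∀ {i X c U b} → Con 𝔸 c U → A.Ents i X (c ∷ U) → H c U b → H i X b
  ap-cut cU X⊨cU UHb =
    ap-c (A.ent⇒con X⊨c) (A.ax-vi cRi cU) (λ m → X⊨cU (there m)) (ap-d cRi cU UHb)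
    where
      X⊨c = X⊨cU (here refl)
      cRi = A.ent⇒con-singleton X⊨c

  ap-cut* : ∀ {i X c U Y} → Con 𝔸 c U → A.Ents i X (c ∷ U) →
            Lift* (H c) U Y → Lift* (H i) X Y
  ap-cut* cU X⊨cU UHY m = ap-cut cU X⊨cU (UHY m)

  interpolateʳ : ∀ {i X Y} → Con 𝔸 i X → Lift* (H i) X Y →
                 Σ (Car 𝔹) λ e → Σ (List (Car 𝔹)) λ V →
                   Con 𝔹 e V × Lift* (H i) X (e ∷ V) × B.Ents e V Y
  interpolateʳ cX XHY =
    let (c , e , U , V , cU , cV , X⊨cU , UHeV , V⊨Y) = ap-e cX XHY
    in e , V , cV , ap-cut* cU X⊨cU UHeV , V⊨Y

  interpolateˡ : ∀ {i X Y} → Con 𝔸 i X → Lift* (H i) X Y →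
                 Σ (Car 𝔸) λ c → Σ (List (Car 𝔸)) λ U →
                   Con 𝔸 c U × A.Ents i X (c ∷ U) × Lift* (H c) U Y
  interpolateˡ cX XHY =
    let (c , e , U , V , cU , cV , X⊨cU , UHeV , V⊨Y) = ap-e cX XHY
    in c , U , cU , X⊨cU , ap-a* cU cV UHeV V⊨Y

module _ {𝔸 𝔹 ℂ : CIF} {f : RelFam 𝔸 𝔹} {g : RelFam 𝔹 ℂ}
         (fap : IsApprox 𝔸 𝔹 f) (gap : IsApprox 𝔹 ℂ g) where
  private
    module F = ApproxLaws fap
    module G = ApproxLaws gap

  -- The middle sets of the single composites are merged by one more
  -- interpolation of f over their union.
  compR-interpolant : ∀ {c U} → Con 𝔸 c U → (Y : List (Car ℂ)) →
                      Lift* (compR 𝔸 𝔹 ℂ f g c) U Y →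
                      Σ (Car 𝔹) λ e → Σ (List (Car 𝔹)) λ V →
                        Con 𝔹 e V × Lift* (f c) U (e ∷ V) × Lift* (g e) V Y
  compR-interpolant cU [] _ =
    let (e , V , cV , UfeV , _) = F.interpolateʳ {Y = []} cU (λ ())
    in e , V , cV , UfeV , λ ()
  compR-interpolant cU (a ∷ Y) UfgaY =
    let (e₁ , V₁ , cV₁ , Ufe₁V₁ , V₁gY) = compR-interpolant cU Y (λ m → UfgaY (there m))
        (e₂ , V₂ , cV₂ , Ufe₂V₂ , V₂ga) = UfgaY (here refl)
        (e , V , cV , UfeV , V⊨both) =
          F.interpolateʳ cU (all-++ (e₁ ∷ V₁) Ufe₁V₁ Ufe₂V₂)
        V⊨e₁V₁ = λ {x} (m : x ∈ e₁ ∷ V₁) → V⊨both (∈-++⁺ˡ m)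
        V⊨e₂V₂ = λ {x} (m : x ∈ e₂ ∷ V₂) → V⊨both (∈-++⁺ʳ (e₁ ∷ V₁) m)
    in e , V , cV , UfeV ,
       λ { (here refl) → G.ap-cut cV₂ V⊨e₂V₂ V₂ga
         ; (there m)   → G.ap-cut* cV₁ V⊨e₁V₁ V₁gY m }

module StrongCompletion (𝔸 : CIF) where
  open CIFLaws 𝔸

  record Tok : Set where
    constructor tok
    field
      tc   : Car 𝔸
      tU   : List (Car 𝔸)
      tcon : Con 𝔸 tc tU
  open Tok public

  members : Tok → List (Car 𝔸)
  members t = tc t ∷ tU t

  -- The first alternative is what makes {p} ∈ Con_p hold; every other
  -- consistent set is entailed by p, which is strongness.
  ConS : Tok → List Tok → Set
  ConS p P = P ⊆ [ p ] ⊎ (∀ {q} → q ∈ P → Ents (tc p) (tU p) (members q))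

  EntS : Tok → List Tok → Tok → Set
  EntS p P q = ConS p P × Ents (tc p) (tU p) (members q)

  ConS-[] : ∀ {p} → ConS p []
  ConS-[] = inj₁ (λ ())

  ConS-sub : ∀ {p P Q} → Q ⊆ P → ConS p P → ConS p Q
  ConS-sub Q⊆P (inj₁ P⊆[p]) = inj₁ (P⊆[p] ∘ Q⊆P)
  ConS-sub Q⊆P (inj₂ p⊨P)   = inj₂ (p⊨P ∘ Q⊆P)

  transport : ∀ {𝔹 : CIF} {H : RelFam 𝔸 𝔹} {p q b} → IsApprox 𝔸 𝔹 H →
              ConS q [ p ] → H (tc p) (tU p) b → H (tc q) (tU q) b
  transport _ (inj₁ [p]⊆[q]) pHb with [p]⊆[q] (here refl)
  ... | here refl = pHb
  transport {p = p} ap (inj₂ q⊨p) pHb = ApproxLaws.ap-cut ap (tcon p) (q⊨p (here refl)) pHb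

  ConS-inherit : ∀ {p q P} → ConS q [ p ] → ConS p P → ConS q P
  ConS-inherit pRq (inj₁ P⊆[p]) = ConS-sub P⊆[p] pRq
  ConS-inherit pRq (inj₂ p⊨P)   = inj₂ (λ m n → transport ent-isApprox pRq (p⊨P m n))

  isCIFS : IsCIF Tok ConS EntS
  isCIFS = record
    { ent⇒con = proj₁
    ; ax-i    = λ _ → inj₁ (λ m → m)
    ; ax-ii   = ConS-sub
    ; ax-iii  = λ _ P⊨Q → inj₂ (λ m → proj₂ (P⊨Q m))
    ; ax-iv   = λ _ cQ _ pPq → cQ , proj₂ pPq
    ; ax-v    = λ cP _ pQb → cP , proj₂ pQb
    ; ax-vi   = ConS-inherit
    ; ax-vii  = λ pRq cP pPb →
        ConS-inherit pRq cP , (λ m → transport ent-isApprox pRq (proj₂ pPb m))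
    ; ax-viii = interpolate
    }
    where
      interpolate : ∀ {p P Q} → ConS p P → Lift* (EntS p) P Q →
                    Σ Tok λ e → Σ (List Tok) λ Z →
                      ConS e Z × Lift* (EntS p) P (e ∷ Z) × Lift* (EntS e) Z Q
      interpolate {p} {P} cP P⊨Q =
        let (e , Z , cZ , p⊨eZ , Z⊨Q) =
              ax-viii (tcon p) (all-concatMap⁺ members (λ m → proj₂ (P⊨Q m)))
        in tok e Z cZ , [] , ConS-[] , singleton-all {P = EntS p P} (cP , p⊨eZ) ,
           (λ m → ConS-[] , all-concatMap⁻ members Z⊨Q m)

  strongCIF : CIF
  strongCIF = record { Car = Tok ; Con = ConS ; Ent = EntS ; isCIF = isCIFS }

  isStrong : IsStrong strongCIF
  isStrong p P (inj₁ P⊆[p]) P≠[p] m with P⊆[p] m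
  ... | here refl = ⊥-elim (P≠[p] (P⊆[p] , singleton-all {P = _∈ P} m))
  isStrong p P (inj₂ p⊨P) _ m = inj₁ (λ n → n) , p⊨P m

_ˢ : CIF → CIF
_ˢ = StrongCompletion.strongCIF

module _ {𝔸 𝔹 : CIF} where
  private
    module SA = StrongCompletion 𝔸
    module SB = StrongCompletion 𝔹

  _⨾α : Hom 𝔸 𝔹 → Hom 𝔸 (𝔹 ˢ)
  rel (f ⨾α) i X q = Lift* (rel f i) X (SB.members q)
  isApprox (f ⨾α) = record
    { h⇒con = λ Xfq → F.h⇒con (Xfq (here refl))
    ; ap-a  = λ { {k = k} cX _ XfkY kYb →
        F.ap-a* cX (SB.tcon k) (XfkY (here refl)) (proj₂ kYb) }
    ; ap-b  = λ cX cX' X⊆X' Xfb m → F.ap-b cX cX' X⊆X' (Xfb m)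
    ; ap-c  = λ cX cX' X⊨X' X'fb m → F.ap-c cX cX' X⊨X' (X'fb m)
    ; ap-d  = λ iRj cX Xfb m → F.ap-d iRj cX (Xfb m)
    ; ap-e  = λ cX XfF →
        let (c , e , U , V , cU , cV , X⊨cU , Ufe , V⊨F) =
              F.ap-e cX (all-concatMap⁺ SB.members XfF)
        in c , SB.tok e V cV , U , [] , cU , SB.ConS-[] , X⊨cU ,
           singleton-all {P = rel (f ⨾α) c U} Ufe ,
           (λ m → SB.ConS-[] , all-concatMap⁻ SB.members V⊨F m)
    }
    where module F = ApproxLaws (isApprox f)

  β⨾_ : Hom 𝔸 𝔹 → Hom (𝔸 ˢ) 𝔹
  rel (β⨾ f) p P b = SA.ConS p P × rel f (SA.tc p) (SA.tU p) b
  isApprox (β⨾ f) = record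
    { h⇒con = proj₁
    ; ap-a  = λ { {i = p} cP cY PfkY kYb →
        cP , F.ap-a (SA.tcon p) cY (λ m → proj₂ (PfkY m)) kYb }
    ; ap-b  = λ _ cP' _ Pfb → cP' , proj₂ Pfb
    ; ap-c  = λ cP _ _ P'fb → cP , proj₂ P'fb
    ; ap-d  = λ pRq cP Pfb →
        SA.ConS-inherit pRq cP , SA.transport (isApprox f) pRq (proj₂ Pfb)
    ; ap-e  = λ { {i = p} {X = P} cP PfF →
        let (c , e , U , V , cU , cV , p⊨cU , Ufe , V⊨F) =
              F.ap-e (SA.tcon p) (λ m → proj₂ (PfF m))
        in SA.tok c U cU , e , [] , V , SA.ConS-[] , cV ,
           singleton-all {P = SA.EntS p P} (cP , p⊨cU) , (λ m → SA.ConS-[] , Ufe m) , V⊨F }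
    }
    where module F = ApproxLaws (isApprox f)

β⨾-⨾α-assoc : ∀ {𝔸 𝔹} (f : Hom 𝔸 𝔹) → ((β⨾ f) ⨾α) ≈H (β⨾ (f ⨾α))
β⨾-⨾α-assoc f p P q = (λ Pfq → proj₁ (Pfq (here refl)) , λ m → proj₂ (Pfq m)) ,
                      (λ (cP , pfq) m → cP , pfq m)

α : (𝔸 : CIF) → Hom 𝔸 (𝔸 ˢ)
α 𝔸 = idᴴ 𝔸 ⨾α

β : (𝔸 : CIF) → Hom (𝔸 ˢ) 𝔸
β 𝔸 = β⨾ idᴴ 𝔸

strongHom : ∀ {𝔸 𝔹} → Hom 𝔸 𝔹 → Hom (𝔸 ˢ) (𝔹 ˢ)
strongHom f = β⨾ (f ⨾α)

strongHom-resp : ∀ {𝔸 𝔹} (f g : Hom 𝔸 𝔹) → f ≈H g → strongHom f ≈H strongHom g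
strongHom-resp f g f≈g p P q =
  (λ (cP , pfq) → cP , λ m → proj₁ (f≈g _ _ _) (pfq m)) ,
  (λ (cP , pgq) → cP , λ m → proj₂ (f≈g _ _ _) (pgq m))

⨾α-composite : ∀ {𝔸 𝔹} (f : Hom 𝔸 𝔹) → EqR 𝔸 (𝔹 ˢ) (f ⨾ α 𝔹) (rel (f ⨾α))
⨾α-composite f i X q = to , from
  where
    module F = ApproxLaws (isApprox f)
    to : (f ⨾ α _) i X q → rel (f ⨾α) i X q
    to (_ , _ , cV , XfeV , V⊨q) = F.ap-a* (F.h⇒con (XfeV (here refl))) cV XfeV V⊨q
    from : rel (f ⨾α) i X q → (f ⨾ α _) i X q
    from Xfq = F.interpolateʳ (F.h⇒con (Xfq (here refl))) Xfq

module _ {𝔸 ℂ : CIF} where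
  open StrongCompletion 𝔸

  α⨾β⨾-cancel : (f : Hom 𝔸 ℂ) → EqR 𝔸 ℂ (α 𝔸 ⨾ (β⨾ f)) (rel f)
  α⨾β⨾-cancel f i X b = to , from
    where
      module F = ApproxLaws (isApprox f)
      to : (α 𝔸 ⨾ (β⨾ f)) i X b → rel f i X b
      to (t , _ , _ , X⊨tT , (_ , tfb)) = F.ap-cut (tcon t) (X⊨tT (here refl)) tfb
      from : rel f i X b → (α 𝔸 ⨾ (β⨾ f)) i X b
      from Xfb =
        let (c , U , cU , X⊨cU , Ufb) = F.interpolateˡ (F.h⇒con Xfb) (singleton-all Xfb)
        in tok c U cU , [] , ConS-[] , singleton-all {P = rel (α 𝔸) i X} X⊨cU ,
           ConS-[] , Ufb (here refl)

  β⨾-composite : (f : Hom 𝔸 ℂ) → EqR (𝔸 ˢ) ℂ (β 𝔸 ⨾ f) (rel (β⨾ f))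
  β⨾-composite f p P b = to , from
    where
      module F = ApproxLaws (isApprox f)
      to : (β 𝔸 ⨾ f) p P b → rel (β⨾ f) p P b
      to (_ , _ , cV , P⊨aV , Vfb) =
        proj₁ (P⊨aV (here refl)) , F.ap-cut cV (λ m → proj₂ (P⊨aV m)) Vfb
      from : rel (β⨾ f) p P b → (β 𝔸 ⨾ f) p P b
      from (cP , pfb) =
        let (a , V , cV , p⊨aV , Vfb) = F.interpolateˡ (tcon p) (singleton-all pfb)
        in a , V , cV , (λ m → cP , p⊨aV m) , Vfb (here refl)

  β⨾-unique : (f : Hom 𝔸 ℂ) (g : Hom (𝔸 ˢ) ℂ) → f ≈ (α 𝔸 ⨾ g) → g ≈H (β⨾ f)
  β⨾-unique f g f≈αg p P b = to , from
    where
      module G = ApproxLaws (isApprox g)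
      to : rel g p P b → rel (β⨾ f) p P b
      to Pgb =
        let cP = G.h⇒con Pgb
            (t , T , cT , P⊨tT , Tgb) = G.interpolateˡ cP (singleton-all Pgb)
        in cP , proj₂ (f≈αg _ _ _) (t , T , cT , (λ m → proj₂ (P⊨tT m)) , Tgb (here refl))
      -- p entails t ∷ T, so T g_t b moves along t R p to T g_p b,
      -- then to t ∷ T and back to P.
      from : rel (β⨾ f) p P b → rel g p P b
      from (cP , pfb) with proj₁ (f≈αg _ _ _) pfb
      ... | t , T , cT , p⊨tT , Tgb = G.ap-c cP c[tT] (λ m → cP , p⊨tT m) tTgb
        where
          c[tT] : ConS p (t ∷ T)
          c[tT] = inj₂ p⊨tT
          tRp : ConS p [ t ]
          tRp = ConS-sub (singleton-all {P = _∈ t ∷ T} (here refl)) c[tT]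
          tTgb : rel g p (t ∷ T) b
          tTgb = G.ap-b (ConS-inherit tRp cT) c[tT] there (G.ap-d tRp cT Tgb)

module _ {𝔸 𝔹 : CIF} (f : Hom 𝔸 𝔹) where
  private
    module SA = StrongCompletion 𝔸
    module SB = StrongCompletion 𝔹
    module F = ApproxLaws (isApprox f)

  strongHom⨾β : EqR (𝔸 ˢ) 𝔹 (strongHom f ⨾ β 𝔹) (rel (β⨾ f))
  strongHom⨾β p P b = to , from
    where
      to : (strongHom f ⨾ β 𝔹) p P b → rel (β⨾ f) p P b
      to (t , _ , _ , Pft , (_ , t⊨b)) =
        proj₁ (Pft (here refl)) , F.ap-a (SA.tcon p) (SB.tcon t) (proj₂ (Pft (here refl))) t⊨b
      from : rel (β⨾ f) p P b → (strongHom f ⨾ β 𝔹) p P b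
      from (cP , pfb) =
        let (e , V , cV , pfeV , V⊨b) = F.interpolateʳ (SA.tcon p) (singleton-all pfb)
        in SB.tok e V cV , [] , SB.ConS-[] ,
           singleton-all {P = rel (strongHom f) p P} (cP , pfeV) , SB.ConS-[] , V⊨b (here refl)

  strongHom-⨾ : ∀ {ℂ} (g : Hom 𝔹 ℂ) (h : Hom 𝔸 ℂ) →
                h ≈ (f ⨾ g) → strongHom h ≈ (strongHom f ⨾ strongHom g)
  strongHom-⨾ g h h≈fg p P r = to , from
    where
      to : rel (strongHom h) p P r → (strongHom f ⨾ strongHom g) p P r
      to (cP , phr) =
        let (e , V , cV , pfeV , Vgr) =
              compR-interpolant (isApprox f) (isApprox g) (SA.tcon p) _
                (λ m → proj₁ (h≈fg _ _ _) (phr m))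
        in SB.tok e V cV , [] , SB.ConS-[] ,
           singleton-all {P = rel (strongHom f) p P} (cP , pfeV) , SB.ConS-[] , Vgr
      from : (strongHom f ⨾ strongHom g) p P r → rel (strongHom h) p P r
      from (t , _ , _ , Pft , (_ , tgr)) =
        proj₁ (Pft (here refl)) ,
        λ m → proj₂ (h≈fg _ _ _)
                (SB.tc t , SB.tU t , SB.tcon t , proj₂ (Pft (here refl)) , tgr m)

α⨾β≈id : (𝔸 : CIF) → EqR 𝔸 𝔸 (α 𝔸 ⨾ β 𝔸) (Ent 𝔸)
α⨾β≈id 𝔸 = α⨾β⨾-cancel (idᴴ 𝔸)

β⨾α≈id : (𝔸 : CIF) → EqR (𝔸 ˢ) (𝔸 ˢ) (β 𝔸 ⨾ α 𝔸) (Ent (𝔸 ˢ))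
β⨾α≈id 𝔸 = EqR-trans {𝔸 ˢ} {𝔸 ˢ} (⨾α-composite (β 𝔸)) (β⨾-⨾α-assoc (idᴴ 𝔸))

α-natural : ∀ {𝔸 𝔹} (f : Hom 𝔸 𝔹) → EqR 𝔸 (𝔹 ˢ) (f ⨾ α 𝔹) (α 𝔸 ⨾ strongHom f)
α-natural {𝔸} {𝔹} f =
  EqR-trans {𝔸} {𝔹 ˢ} (⨾α-composite f) (EqR-sym {𝔸} {𝔹 ˢ} (α⨾β⨾-cancel (f ⨾α)))

β-natural : ∀ {𝔸 𝔹} (f : Hom 𝔸 𝔹) → EqR (𝔸 ˢ) 𝔹 (strongHom f ⨾ β 𝔹) (β 𝔸 ⨾ f)
β-natural {𝔸} {𝔹} f =
  EqR-trans {𝔸 ˢ} {𝔹} (strongHom⨾β f) (EqR-sym {𝔸 ˢ} {𝔹} (β⨾-composite f))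

SIF-reflective : SIFReflective
SIF-reflective 𝔸 = (𝔸 ˢ , StrongCompletion.isStrong 𝔸) , α 𝔸 ,
                   λ 𝔹 f → β⨾ f , EqR-sym {𝔸} {proj₁ 𝔹} (α⨾β⨾-cancel f) , β⨾-unique f

strengthen : Functor {CIF} {SIFObj} (λ 𝔸 → 𝔸) proj₁
strengthen = record
  { F₀     = λ 𝔸 → 𝔸 ˢ , StrongCompletion.isStrong 𝔸
  ; F₁     = strongHom
  ; F-resp = strongHom-resp
  ; F-id   = λ h → strongHom-resp h (idᴴ _)
  ; F-comp = λ f g → strongHom-⨾ f g
  }

forget : Functor {SIFObj} {CIF} proj₁ (λ 𝔸 → 𝔸)
forget = record
  { F₀ = proj₁ ; F₁ = λ f → f
  ; F-resp = λ _ _ f≈g → f≈g ; F-id = λ _ h≈id → h≈id ; F-comp = λ _ _ _ h≈fg → h≈fg }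

unitIso : NatIso (idF (λ 𝔸 → 𝔸)) (strengthen ⨾F forget)
unitIso = record
  { α       = α
  ; α⁻¹     = β
  ; iso₁    = α⨾β≈id
  ; iso₂    = β⨾α≈id
  ; natural = α-natural
  }

counitIso : NatIso (forget ⨾F strengthen) (idF proj₁)
counitIso = record
  { α       = β ∘ proj₁
  ; α⁻¹     = α ∘ proj₁
  ; iso₁    = β⨾α≈id ∘ proj₁
  ; iso₂    = α⨾β≈id ∘ proj₁
  ; natural = β-natural
  }

theorem5p6 : SIFReflective × Equivalence {CIF} {SIFObj} (λ 𝔸 → 𝔸) proj₁
theorem5p6 = SIF-reflective , record
  { L = strengthen ; R = forget ; unit = unitIso ; counit = counitIso }
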